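{- Let $u$ be the state space of an event system whose events form a finite set $\mathcal{S}$ of conjunctive set transformers on $\mathcal{P}(u)$ with $G(u)=u$ for $G\in\mathcal{S}$, let $S(r)=\bigcap_{G\in\mathcal{S}}G(r)$, $\mathrm{grd}(S)=\overline{S(\varnothing)}$, let $\mathit{init}\subseteq u$ be the set of initial states and $\mathit{si}$ the smallest $X\subseteq u$ with $\mathit{init}\subseteq X$ and $X\subseteq S(X)$. For $b\subseteq u$ let $\mathcal{F}_m(b)(x)=b\cup(\mathrm{grd}(S)\cap S(x))$. Define $$\mathcal{T}_m=\{(a,b)\mid a,b\subseteq u,\ \mathit{si}\cap a\subseteq\mathrm{fix}(\mathcal{F}_m(\mathit{si}\cap b))\},\qquad \mathcal{E}_m=\{(a,b)\mid a,b\subseteq u,\ \mathit{si}\cap a\cap\overline{b}\subseteq S(b)\cap\mathrm{grd}(S)\},$$ and let $\mathcal{L}_m$ be the smallest relation on $\mathcal{P}(u)$ containing $\mathcal{E}_m$ that is transitive and disjunctive (for every $q\subseteq u$ and family $l\subseteq\mathcal{P}(u)$ with $(p,q)\in\mathcal{L}_m$ for all $p\in l$, $(\bigcup l,q)\in\mathcal{L}_m$). Then $\mathcal{T}_m=\mathcal{L}_m$.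
   Context: $\overline{p}=u\setminus p$; $\mathrm{fix}$ is least fixpoint. $\mathit{si}$ is the set of states satisfying the strongest invariant of the system. -}

module Defs where

open import Level using (Level; suc; Lift)
open import Data.Empty using (⊥)
open import Data.Unit.Polymorphic using (⊤)
open import Data.Product using (Σ; ∃; _×_; proj₁)
open import Data.List using (List; []; _∷_)
open import Relation.Unary using (Pred; _⊆_; _≐_; _∩_; _∪_; ∁; ⋃)

private
  variable
    ℓ : Level
    U : Set ℓ

Trans : (U : Set ℓ) → Set (suc ℓ)
Trans {ℓ} U = Pred U ℓ → Pred U ℓ

∅ₗ : {U : Set ℓ} → Pred U ℓ
∅ₗ {ℓ = ℓ} = λ _ → Lift ℓ ⊥

fullₗ : {U : Set ℓ} → Pred U ℓ
fullₗ = λ _ → ⊤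

⋂fam : {U : Set ℓ} → Pred (Pred U ℓ) ℓ → Pred U (suc ℓ)
⋂fam l = λ x → ∀ p → l p → p x

⋃fam : {U : Set ℓ} → Pred (Pred U ℓ) ℓ → Pred U (suc ℓ)
⋃fam l = ⋃ (Σ _ l) proj₁

Conjunctive : {U : Set ℓ} → Trans U → Set (suc ℓ)
Conjunctive {U = U} G =
  (l : Pred (Pred U _) _) → (∃ λ p → l p) →
  (r : Pred U _) → r ≐ ⋂fam l →
  G r ≐ (λ x → ∀ p → l p → G p x)

Sₘ : {U : Set ℓ} → List (Trans U) → Trans U
Sₘ [] r = fullₗ
Sₘ (G ∷ Gs) r = G r ∩ Sₘ Gs r

grd : {U : Set ℓ} → List (Trans U) → Pred U ℓ
grd evs = ∁ (Sₘ evs ∅ₗ)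

si : {U : Set ℓ} → List (Trans U) → Pred U ℓ → Pred U (suc ℓ)
si evs init = λ s → ∀ X → init ⊆ X → X ⊆ Sₘ evs X → X s

-- least fixpoint of a monotone F, as the intersection of all pre-fixpoints
fix : {U : Set ℓ} {ℓ′ : Level} → (Pred U ℓ → Pred U ℓ′) → Pred U (suc ℓ Level.⊔ ℓ′)
fix F = λ s → ∀ X → F X ⊆ X → X s

𝓕ₘ : {U : Set ℓ} {ℓ′ : Level} → List (Trans U) → Pred U ℓ′ → Pred U ℓ → Pred U _
𝓕ₘ evs b x = b ∪ (grd evs ∩ Sₘ evs x)

𝒯ₘ : {U : Set ℓ} → List (Trans U) → Pred U ℓ → Pred U ℓ → Pred U ℓ → Set (suc ℓ)
𝒯ₘ evs init a b = (si evs init ∩ a) ⊆ fix (𝓕ₘ evs (si evs init ∩ b))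

ℰₘ : {U : Set ℓ} → List (Trans U) → Pred U ℓ → Pred U ℓ → Pred U ℓ → Set (suc ℓ)
ℰₘ evs init a b = (si evs init ∩ a ∩ ∁ b) ⊆ (Sₘ evs b ∩ grd evs)

data ℒₘ {U : Set ℓ} (evs : List (Trans U)) (init : Pred U ℓ) : Pred U ℓ → Pred U ℓ → Set (suc ℓ) where
  base  : ∀ {a b} → ℰₘ evs init a b → ℒₘ evs init a b
  trans : ∀ {a b c} → ℒₘ evs init a b → ℒₘ evs init b c → ℒₘ evs init a c
  disj  : (l : Pred (Pred U ℓ) ℓ) (q a : Pred U ℓ) → a ≐ ⋃fam l →
          (∀ p → l p → ℒₘ evs init p q) → ℒₘ evs init a q

-- Soundness (ℒₘ ⊆ 𝒯ₘ) is by induction on ℒₘ: an ℰₘ step is one unfolding of fix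
-- (using si ⊆ S(si) and conjunctivity), transitivity composes least fixpoints, and
-- disjunctivity is pointwise. For completeness let Z be the union of all p with
-- (p, b) ∈ ℒₘ. Then (Z, b) ∈ ℒₘ, and Z is a pre-fixpoint of 𝓕ₘ(si ∩ b) because
-- (grd(S) ∩ S(Z), Z) ∈ ℰₘ; hence si ∩ a ⊆ fix(𝓕ₘ(si ∩ b)) ⊆ Z, i.e. (a, Z) ∈ ℰₘ.
-- Excluded middle is used to decide membership and to resize the large predicates
-- si, fix and Z back to the universe of subsets of u.
module Submission where

open import Defs
open import Level using (Level; suc; Lift; lift; lower)
open import Axiom.ExcludedMiddle using (ExcludedMiddle)
open import Data.Product using (_×_; _,_; proj₁; proj₂)
open import Data.Sum using (_⊎_; inj₁; inj₂)
open import Data.Empty using (⊥-elim)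
open import Data.List using (List; []; _∷_)
open import Data.List.Relation.Unary.All using (All; []; _∷_)
open import Relation.Nullary using (Dec; yes; no)
open import Relation.Nullary.Decidable using (True; toWitness; fromWitness; map′)
open import Relation.Unary using (Pred; _≐_; _⊆_; _∩_)
open import Relation.Unary.Properties using (≐-refl)

module Resizing {ℓ : Level} (em : ExcludedMiddle (suc ℓ)) where

  Resized : Set (suc ℓ) → Set ℓ
  Resized A = Lift ℓ (True (em {A}))

  resize : {A : Set (suc ℓ)} → A → Resized A
  resize a = lift (fromWitness a)

  unresize : {A : Set (suc ℓ)} → Resized A → A
  unresize r = toWitness (lower r)

  resizeₚ : {U : Set ℓ} → Pred U (suc ℓ) → Pred U ℓ
  resizeₚ P x = Resized (P x)

  resizeₚ-≐ : {U : Set ℓ} (P : Pred U (suc ℓ)) → resizeₚ P ≐ P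
  resizeₚ-≐ P = unresize , resize

  em-lower : (A : Set ℓ) → Dec A
  em-lower A = map′ lower lift (em {Lift (suc ℓ) A})

module _ {ℓ : Level} {U : Set ℓ} {G : Trans U} (conj : Conjunctive G) where

  private
    pair : Pred U ℓ → Pred U ℓ → Pred (Pred U ℓ) ℓ
    pair p q r = (r ≐ p) ⊎ (r ≐ q)

    pair-⋂ : {p q r : Pred U ℓ} → r ⊆ p → r ⊆ q → p ∩ q ⊆ r → r ≐ ⋂fam (pair p q)
    pair-⋂ r⊆p r⊆q p∩q⊆r =
      (λ { rx s (inj₁ s≐p) → proj₂ s≐p (r⊆p rx) ; rx s (inj₂ s≐q) → proj₂ s≐q (r⊆q rx) })
      , (λ f → p∩q⊆r (f _ (inj₁ ≐-refl) , f _ (inj₂ ≐-refl)))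

  conjunctive-mono : ∀ {p q} → p ⊆ q → G p ⊆ G q
  conjunctive-mono {p} {q} p⊆q Gp =
    proj₁ (conj (pair p q) (p , inj₁ ≐-refl) p
                (pair-⋂ (λ z → z) p⊆q proj₁))
          Gp q (inj₂ ≐-refl)

  conjunctive-∩ : ∀ {p q} → G p ∩ G q ⊆ G (p ∩ q)
  conjunctive-∩ {p} {q} (Gp , Gq) =
    proj₂ (conj (pair p q) (p , inj₁ ≐-refl) (p ∩ q)
                (pair-⋂ proj₁ proj₂ (λ z → z)))
          λ { r (inj₁ r≐p) → conjunctive-mono (proj₂ r≐p) Gp
            ; r (inj₂ r≐q) → conjunctive-mono (proj₂ r≐q) Gq }

module _ {ℓ : Level} {U : Set ℓ} where

  Sₘ-conjunctive : ∀ {Gs : List (Trans U)} → All Conjunctive Gs → Conjunctive (Sₘ Gs)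
  Sₘ-conjunctive [] l ne r r≐⋂l = (λ _ _ _ → _) , (λ _ → _)
  Sₘ-conjunctive {G ∷ Gs} (c ∷ cs) l ne r r≐⋂l =
    (λ { (Gr , Sr) p lp → proj₁ G≐ Gr p lp , proj₁ S≐ Sr p lp })
    , (λ f → proj₂ G≐ (λ p lp → proj₁ (f p lp)) , proj₂ S≐ (λ p lp → proj₂ (f p lp)))
    where
      G≐ : G r ≐ (λ x → ∀ p → l p → G p x)
      G≐ = c l ne r r≐⋂l
      S≐ : Sₘ Gs r ≐ (λ x → ∀ p → l p → Sₘ Gs p x)
      S≐ = Sₘ-conjunctive cs l ne r r≐⋂l

  Sₘ-full : ∀ {Gs : List (Trans U)} → All (λ G → G fullₗ ≐ fullₗ) Gs → fullₗ ⊆ Sₘ Gs fullₗ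
  Sₘ-full [] _ = _
  Sₘ-full (G≐full ∷ Gs≐full) t = proj₂ G≐full t , Sₘ-full Gs≐full t

module _ {ℓ : Level} {U : Set ℓ} (em : ExcludedMiddle (suc ℓ)) where
  open Resizing em

  fix-unfold : {F : Pred U ℓ → Pred U (suc ℓ)} → (∀ {X Y} → X ⊆ Y → F X ⊆ F Y) →
               F (resizeₚ (fix F)) ⊆ fix F
  fix-unfold F-mono Fx X F⊆X = F⊆X (F-mono (λ y → unresize y X F⊆X) Fx)

module EventSystem {ℓ : Level} {U : Set ℓ} (em : ExcludedMiddle (suc ℓ))
  (evs : List (Trans U)) (conj : All Conjunctive evs)
  (evs-full : All (λ G → G fullₗ ≐ fullₗ) evs) (init : Pred U ℓ) where

  open Resizing em

  private
    S : Trans U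
    S = Sₘ evs

    S-conj : Conjunctive S
    S-conj = Sₘ-conjunctive conj

    S-mono : ∀ {p q} → p ⊆ q → S p ⊆ S q
    S-mono = conjunctive-mono S-conj

    sī : Pred U ℓ
    sī = resizeₚ (si evs init)

    𝓕 : Pred U (suc ℓ) → Pred U ℓ → Pred U (suc ℓ)
    𝓕 = 𝓕ₘ evs

    𝓕-mono : ∀ {b X Y} → X ⊆ Y → 𝓕 b X ⊆ 𝓕 b Y
    𝓕-mono X⊆Y (inj₁ bx) = inj₁ bx
    𝓕-mono X⊆Y (inj₂ (g , SX)) = inj₂ (g , S-mono X⊆Y SX)

  -- si is the intersection of the nonempty family of inductive invariants, each a post-fixpoint of S.
  si⊆S-si : si evs init ⊆ S sī
  si⊆S-si six =
    proj₂ (S-conj Inv (fullₗ , (λ _ → _) , Sₘ-full evs-full) sī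
                  ((λ r X InvX → unresize r X (proj₁ InvX) (proj₂ InvX))
                  , (λ f → resize (λ X init⊆X X⊆SX → f X ((λ {y} → init⊆X {y}) , (λ {y} → X⊆SX {y}))))))
          (λ X InvX → proj₂ InvX (six X (proj₁ InvX) (proj₂ InvX)))
    where
      Inv : Pred (Pred U ℓ) ℓ
      Inv X = init ⊆ X × X ⊆ S X

  ℰₘ⇒𝒯ₘ : ∀ {a b} → ℰₘ evs init a b → 𝒯ₘ evs init a b
  ℰₘ⇒𝒯ₘ {a} {b} e {s} (sis , as) X 𝓕X⊆X with em-lower (b s)
  ... | yes bs = 𝓕X⊆X (inj₁ (sis , bs))
  ... | no ¬bs = 𝓕X⊆X (inj₂ (g , S-mono si∩b⊆X (conjunctive-∩ S-conj (si⊆S-si sis , Sb))))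
    where
      Sb : S b s
      Sb = proj₁ (e (sis , as , ¬bs))
      g : grd evs s
      g = proj₂ (e (sis , as , ¬bs))
      si∩b⊆X : sī ∩ b ⊆ X
      si∩b⊆X (r , bx) = 𝓕X⊆X (inj₁ (unresize r , bx))

  𝒯ₘ-trans : ∀ {a b c} → 𝒯ₘ evs init a b → 𝒯ₘ evs init b c → 𝒯ₘ evs init a c
  𝒯ₘ-trans {a} {b} {c} ab bc sia X 𝓕X⊆X = unresize (ab sia Y 𝓕Y⊆Y) X 𝓕X⊆X
    where
      Y : Pred U ℓ
      Y = resizeₚ (fix (𝓕 (si evs init ∩ c)))
      𝓕Y⊆Y : 𝓕 (si evs init ∩ b) Y ⊆ Y
      𝓕Y⊆Y (inj₁ sib) = resize (bc sib)
      𝓕Y⊆Y (inj₂ gSY) = resize (fix-unfold em 𝓕-mono (inj₂ gSY))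

  𝒯ₘ-⋃ : ∀ {l a q} → a ⊆ ⋃fam l → (∀ p → l p → 𝒯ₘ evs init p q) → 𝒯ₘ evs init a q
  𝒯ₘ-⋃ a⊆⋃l pq (sis , as) with a⊆⋃l as
  ... | (p , lp) , ps = pq p lp (sis , ps)

  ℒₘ⇒𝒯ₘ : ∀ {a b} → ℒₘ evs init a b → 𝒯ₘ evs init a b
  ℒₘ⇒𝒯ₘ (base e) = ℰₘ⇒𝒯ₘ e
  ℒₘ⇒𝒯ₘ (trans ab bc) = 𝒯ₘ-trans (ℒₘ⇒𝒯ₘ ab) (ℒₘ⇒𝒯ₘ bc)
  ℒₘ⇒𝒯ₘ (disj l q a a≐⋃l pq) = 𝒯ₘ-⋃ (proj₁ a≐⋃l) (λ p lp → ℒₘ⇒𝒯ₘ (pq p lp))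

  ⊆⇒ℰₘ : ∀ {p q} → si evs init ∩ p ⊆ q → ℰₘ evs init p q
  ⊆⇒ℰₘ si∩p⊆q (sis , px , ¬qx) = ⊥-elim (¬qx (si∩p⊆q (sis , px)))

  𝒯ₘ⇒ℒₘ : ∀ {a b} → 𝒯ₘ evs init a b → ℒₘ evs init a b
  𝒯ₘ⇒ℒₘ {a} {b} t = trans (base (⊆⇒ℰₘ si∩a⊆Z)) Z-ℒₘ-b
    where
      LeadsTo-b : Pred (Pred U ℓ) ℓ
      LeadsTo-b p = Resized (ℒₘ evs init p b)

      Z : Pred U ℓ
      Z = resizeₚ (⋃fam LeadsTo-b)

      Z-ℒₘ-b : ℒₘ evs init Z b
      Z-ℒₘ-b = disj LeadsTo-b b Z (resizeₚ-≐ (⋃fam LeadsTo-b)) (λ p lp → unresize lp)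

      ⊆Z : ∀ {p} → ℒₘ evs init p b → p ⊆ Z
      ⊆Z {p} pLb px = resize ((p , resize pLb) , px)

      𝓕Z⊆Z : 𝓕 (si evs init ∩ b) Z ⊆ Z
      𝓕Z⊆Z (inj₁ (_ , bx)) = ⊆Z (base (⊆⇒ℰₘ proj₂)) bx
      𝓕Z⊆Z (inj₂ gSZ) = ⊆Z {grd evs ∩ S Z} (trans (base λ { (_ , (g , SZ) , _) → SZ , g }) Z-ℒₘ-b) gSZ

      si∩a⊆Z : si evs init ∩ a ⊆ Z
      si∩a⊆Z sia = t sia Z 𝓕Z⊆Z

mainTheorem8 : {ℓ : Level} {U : Set ℓ} → ExcludedMiddle (suc ℓ) →
    (evs : List (Trans U)) → All Conjunctive evs →
    All (λ G → G fullₗ ≐ fullₗ) evs →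
    (init : Pred U ℓ) → (a b : Pred U ℓ) →
    (𝒯ₘ evs init a b → ℒₘ evs init a b) × (ℒₘ evs init a b → 𝒯ₘ evs init a b)
mainTheorem8 em evs conj evs-full init a b = 𝒯ₘ⇒ℒₘ , ℒₘ⇒𝒯ₘ
  where open EventSystem em evs conj evs-full init
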